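{- Let $(\mathcal{V},\mathcal{TV},\mathcal{L},\ell_0,\mathcal{T})$ be an integer program and $\mathcal{C}=\{t_1,\dots,t_n\}\subset\mathcal{T}$ a simple cycle with sequence $t_1,\dots,t_n$, where $t_i$ starts in location $\ell_i$. Let $f:\mathcal{E}_{\mathcal{C}}\to\mathcal{B}$ be such that for every $r\in\mathcal{E}_{\mathcal{C}}$ either $f(r)=\omega$, or $f(r)=1+\pi(\mathtt{rb})$ where, with $i$ such that the target location of $r$ is $\ell_i$, the chained transition $t_i\star\dots\star t_n\star t_1\star\dots\star t_{i-1}$ corresponds via the variable renaming $\pi$ to a loop with runtime bound $\mathtt{rb}$. Then $f$ is a local runtime bound for $\mathcal{C}=\mathcal{T}'_>=\mathcal{T}'$.
   Context: Integer program: finite disjoint sets $\mathcal{V}$ (program variables), $\mathcal{TV}$ (temporary variables), finite locations $\mathcal{L}$ with initial $\ell_0$, transitions $(\ell,\varphi,\eta,\ell')$ with $\ell'\ne\ell_0$, guard $\varphi$ built with $\wedge,\vee$ from atoms $p_1<p_2$ over $\mathbb{Z}[\mathcal{V}\cup\mathcal{TV}]$, update $\eta:\mathcal{V}\to\mathbb{Z}[\mathcal{V}\cup\mathcal{TV}]$; $\mathcal{T}_0$ the transitions from $\ell_0$. States $\sigma:\mathcal{V}\cup\mathcal{TV}\to\mathbb{Z}$, $|\sigma|(v)=|\sigma(v)|$; $(\ell,\sigma)\to_t(\ell',\sigma')$ iff $t=(\ell,\varphi,\eta,\ell')$, $\sigma(\varphi)$ holds and $\sigma'(v)=\sigma(\eta(v))$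 for $v\in\mathcal{V}$. Bounds $\mathcal{B}$: smallest set containing $\mathbb{R}_{\ge0}\cup\{\omega\}$ and variables, closed under $+,\cdot,k^b,\log_k(\max\{1,b\}),\max$ ($k>1$). Entry transitions $\mathcal{E}_{\mathcal{T}'}$: $t=(\ell',\_,\_,\ell)\in\mathcal{T}\setminus\mathcal{T}'$ with some transition of $\mathcal{T}'$ starting in $\ell$. Local runtime bound for $\mathcal{T}'_>\subseteq\mathcal{T}'$: $f:\mathcal{E}_{\mathcal{T}'}\to\mathcal{B}$ with $|\sigma|(f(r))\ge\sup\{k\mid\exists\sigma',(\ell'',\sigma'').(\ell',\sigma')\to_r(\ell,\sigma)(\to^*_{\mathcal{T}'}\circ\to_t)^k(\ell'',\sigma'')\}$ for all $t\in\mathcal{T}'_>$, $r=(\ell',\_,\_,\ell)\in\mathcal{E}_{\mathcal{T}'}$, $\sigma$. $\mathcal{C}$ is a simple cycle with sequence $t_1,\dots,t_n$ if the updates of its transitions contain no temporary variables and there are pairwise different locations $\ell_1,\dots,\ell_n$ with $t_i=(\ell_i,\_,\_,\ell_{i+1})$ for $i<n$ and $t_n=(\ell_n,\_,\_,\ell_1)$. Chaining: for $t_i=(\ell_i,\varphi_i,\eta_i,\ell_{i+1})$, $t_1\star\dots\star t_k=(\ell_1,\varphi,\eta,\ell_{k+1})$ with $\varphi=\varphi_1\wedge\eta_1(\varphi_2)\wedge\eta_1(\eta_2(\varphi_3))\wedge\dots\wedge\eta_1(\dots\eta_{k-1}(\varphi_k)\dots)$ and $\eta(v)=\eta_1(\dots\eta_k(v)\dots)$,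 where $\eta_i(e)$ substitutes $\eta_i(w)$ for every variable $w$ in $e$. A loop $(\varphi',\eta')$ over $\{x_1,\dots,x_d\}$ has runtime complexity $\mathrm{rc}(\sigma)=\min\{m\mid\sigma(\eta'^m(\neg\varphi'))\}$ and runtime bound $\mathtt{rb}$ if $|\sigma|(\mathtt{rb})\ge\mathrm{rc}(\sigma)$ for all integer states. A transition $t=(\ell,\varphi,\eta,\ell)$ with $\varphi$ over $\mathcal{V}'\subseteq\mathcal{V}$ and $\eta(v)\in\mathbb{Z}[\mathcal{V}']$ for $v\in\mathcal{V}'$ corresponds to $(\varphi',\eta')$ via the renaming $\pi:\{x_1,\dots,x_d\}\to\mathcal{V}'$ if $\varphi=\pi(\varphi')$ and $\eta(\pi(x_i))=\pi(\eta'(x_i))$ for all $i$.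
   Formalization: The bounds in $\mathcal{B}$, used for f and for each loop runtime bound rb, have nonnegative rational constants and rational bases k > 1 instead of constants in ℝ≥0 and real k > 1. -}

module Defs where

open import Data.Nat as ℕ using (ℕ; zero; suc)
open import Data.Nat.DivMod using (_mod_)
open import Data.Integer as ℤ using (ℤ; +_; ∣_∣)
open import Data.Rational as ℚ using (ℚ; 0ℚ; 1ℚ)
open import Data.Fin using (Fin; toℕ)
open import Data.Sum using (_⊎_; inj₁; inj₂)
open import Data.Product using (Σ; _×_; _,_; ∃)
open import Data.Unit using (⊤)
open import Data.List using (List; []; _∷_; _++_; [_]; map; upTo)
open import Relation.Binary.PropositionalEquality using (_≡_; _≢_)
open import Relation.Binary.Construct.Closure.ReflexiveTransitive using (Star)
open import Relation.Nullary using (¬_)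
open import Function using (_∘_)

data Poly (X : Set) : Set where
  pconst : ℤ → Poly X
  pvar   : X → Poly X
  _⊕_    : Poly X → Poly X → Poly X
  _⊗_    : Poly X → Poly X → Poly X

evalP : {X : Set} → Poly X → (X → ℤ) → ℤ
evalP (pconst c) σ = c
evalP (pvar x)   σ = σ x
evalP (p ⊕ q)    σ = evalP p σ ℤ.+ evalP q σ
evalP (p ⊗ q)    σ = evalP p σ ℤ.* evalP q σ

bindP : {X Y : Set} → (X → Poly Y) → Poly X → Poly Y
bindP s (pconst c) = pconst c
bindP s (pvar x)   = s x
bindP s (p ⊕ q)    = bindP s p ⊕ bindP s q
bindP s (p ⊗ q)    = bindP s p ⊗ bindP s q

renP : {X Y : Set} → (X → Y) → Poly X → Poly Y
renP π = bindP (pvar ∘ π)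

-- equality of polynomials (as elements of ℤ[X], i.e. as functions on ℤ^X)
_≈P_ : {X : Set} → Poly X → Poly X → Set
p ≈P q = ∀ σ → evalP p σ ≡ evalP q σ

data Formula (X : Set) : Set where
  _<'_ : Poly X → Poly X → Formula X
  _∧'_ : Formula X → Formula X → Formula X
  _∨'_ : Formula X → Formula X → Formula X

Holds : {X : Set} → (X → ℤ) → Formula X → Set
Holds σ (p <' q) = evalP p σ ℤ.< evalP q σ
Holds σ (φ ∧' ψ) = Holds σ φ × Holds σ ψ
Holds σ (φ ∨' ψ) = Holds σ φ ⊎ Holds σ ψ

bindF : {X Y : Set} → (X → Poly Y) → Formula X → Formula Y
bindF s (p <' q) = bindP s p <' bindP s q
bindF s (φ ∧' ψ) = bindF s φ ∧' bindF s ψ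
bindF s (φ ∨' ψ) = bindF s φ ∨' bindF s ψ

renF : {X Y : Set} → (X → Y) → Formula X → Formula Y
renF π = bindF (pvar ∘ π)

data _≈F_ {X : Set} : Formula X → Formula X → Set where
  atom≈ : ∀ {p p' q q'} → p ≈P p' → q ≈P q' → (p <' q) ≈F (p' <' q')
  ∧≈    : ∀ {φ φ' ψ ψ'} → φ ≈F φ' → ψ ≈F ψ' → (φ ∧' ψ) ≈F (φ' ∧' ψ')
  ∨≈    : ∀ {φ φ' ψ ψ'} → φ ≈F φ' → ψ ≈F ψ' → (φ ∨' ψ) ≈F (φ' ∨' ψ')

-- Integer programs:  𝒱 = Fin nV,  𝒯𝒱 = Fin nTV,  ℒ = Fin nL

Var : ℕ → ℕ → Set
Var nV nTV = Fin nV ⊎ Fin nTV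

State : ℕ → ℕ → Set
State nV nTV = Var nV nTV → ℤ

Update : ℕ → ℕ → Set
Update nV nTV = Fin nV → Poly (Var nV nTV)

record Trans (nV nTV nL : ℕ) : Set where
  constructor mkT
  field
    src   : Fin nL
    guard : Formula (Var nV nTV)
    upd   : Update nV nTV
    tgt   : Fin nL
open Trans public

substP : ∀ {nV nTV} → Update nV nTV → Poly (Var nV nTV) → Poly (Var nV nTV)
substP η = bindP λ { (inj₁ v) → η v ; (inj₂ w) → pvar (inj₂ w) }

substF : ∀ {nV nTV} → Update nV nTV → Formula (Var nV nTV) → Formula (Var nV nTV)
substF η = bindF λ { (inj₁ v) → η v ; (inj₂ w) → pvar (inj₂ w) }

applyAllP : ∀ {nV nTV} → List (Update nV nTV) → Poly (Var nV nTV) → Poly (Var nV nTV)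
applyAllP []       e = e
applyAllP (η ∷ ηs) e = substP η (applyAllP ηs e)

applyAllF : ∀ {nV nTV} → List (Update nV nTV) → Formula (Var nV nTV) → Formula (Var nV nTV)
applyAllF []       φ = φ
applyAllF (η ∷ ηs) φ = substF η (applyAllF ηs φ)

-- guard φ₁ ∧ η₁(φ₂) ∧ η₁(η₂(φ₃)) ∧ … of the chain, given the prefix of updates
chainGuard : ∀ {nV nTV nL} → List (Update nV nTV) → Trans nV nTV nL → List (Trans nV nTV nL)
           → Formula (Var nV nTV)
chainGuard pre t []        = applyAllF pre (guard t)
chainGuard pre t (t' ∷ ts) = applyAllF pre (guard t) ∧' chainGuard (pre ++ [ upd t ]) t' ts

lastT : ∀ {nV nTV nL} → Trans nV nTV nL → List (Trans nV nTV nL) → Trans nV nTV nL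
lastT t []        = t
lastT t (t' ∷ ts) = lastT t' ts

chain : ∀ {nV nTV nL} → Trans nV nTV nL → List (Trans nV nTV nL) → Trans nV nTV nL
chain t ts = mkT (src t) (chainGuard [] t ts)
                 (λ v → applyAllP (map upd (t ∷ ts)) (pvar (inj₁ v)))
                 (tgt (lastT t ts))

Config : ℕ → ℕ → ℕ → Set
Config nV nTV nL = Fin nL × State nV nTV

Step : ∀ {nV nTV nL} → Trans nV nTV nL → Config nV nTV nL → Config nV nTV nL → Set
Step t (ℓ , σ) (ℓ' , σ') =
  ℓ ≡ src t × ℓ' ≡ tgt t × Holds σ (guard t) × (∀ v → σ' (inj₁ v) ≡ evalP (upd t v) σ)

_⨾_ : {A : Set} → (A → A → Set) → (A → A → Set) → A → A → Set
(R ⨾ S) a b = Σ _ λ c → R a c × S c b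

Pow : {A : Set} → (A → A → Set) → ℕ → A → A → Set
Pow R zero    a b = a ≡ b
Pow R (suc k) a b = Σ _ λ c → R a c × Pow R k c b

-- Simple cycles, given by the sequence t₁,…,tₙ (n = suc n', 0-based Fin indices)

rot : ∀ {n'} → Fin (suc n') → ℕ → Fin (suc n')
rot {n'} i k = (toℕ i ℕ.+ k) mod (suc n')

NoTemp : ∀ {nV nTV} → Poly (Var nV nTV) → Set
NoTemp (pconst c)   = ⊤
NoTemp (pvar (inj₁ v)) = ⊤
NoTemp (pvar (inj₂ w)) = Data.Empty.⊥ where import Data.Empty
NoTemp (p ⊕ q)      = NoTemp p × NoTemp q
NoTemp (p ⊗ q)      = NoTemp p × NoTemp q

record SimpleCycle {nV nTV nL m n'} (T : Fin m → Trans nV nTV nL) (cyc : Fin (suc n') → Fin m) : Set where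
  field
    noTemp   : ∀ i v → NoTemp (upd (T (cyc i)) v)
    linked   : ∀ i → tgt (T (cyc i)) ≡ src (T (cyc (rot i 1)))
    distinct : ∀ i j → src (T (cyc i)) ≡ src (T (cyc j)) → i ≡ j

InC : ∀ {m n'} → (Fin (suc n') → Fin m) → Fin m → Set
InC cyc j = Σ _ λ i → cyc i ≡ j

IsEntry : ∀ {nV nTV nL m n'} → (Fin m → Trans nV nTV nL) → (Fin (suc n') → Fin m) → Fin m → Set
IsEntry T cyc j = ¬ InC cyc j × Σ _ λ i → tgt (T j) ≡ src (T (cyc i))

rotChain : ∀ {nV nTV nL m n'} → (Fin m → Trans nV nTV nL) → (Fin (suc n') → Fin m)
         → Fin (suc n') → Trans nV nTV nL
rotChain {n' = n'} T cyc i = chain (T (cyc i)) (map (λ k → T (cyc (rot i (suc k)))) (upTo n'))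

data Bound (X : Set) : Set where
  bconst : (c : ℚ) → .(0ℚ ℚ.≤ c) → Bound X
  ω      : Bound X
  bvar   : X → Bound X
  _⊞_    : Bound X → Bound X → Bound X
  _⊠_    : Bound X → Bound X → Bound X
  bpow   : (k : ℚ) → .(1ℚ ℚ.< k) → Bound X → Bound X
  blog   : (k : ℚ) → .(1ℚ ℚ.< k) → Bound X → Bound X     -- log_k(max{1,b})
  bmax   : Bound X → Bound X → Bound X

one : {X : Set} → Bound X
one = bconst 1ℚ (ℚ.*≤* (ℤ.+≤+ ℕ.z≤n))
  where import Data.Rational.Base

renB : {X Y : Set} → (X → Y) → Bound X → Bound Y
renB π (bconst c p) = bconst c p
renB π ω            = ω
renB π (bvar x)     = bvar (π x)
renB π (a ⊞ b)      = renB π a ⊞ renB π b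
renB π (a ⊠ b)      = renB π a ⊠ renB π b
renB π (bpow k p b) = bpow k p (renB π b)
renB π (blog k p b) = blog k p (renB π b)
renB π (bmax a b)   = bmax (renB π a) (renB π b)

_^ℚ_ : ℚ → ℕ → ℚ
q ^ℚ zero  = 1ℚ
q ^ℚ suc n = q ℚ.* (q ^ℚ n)

fracℚ : ℕ → ℕ → ℚ
fracℚ m n = (+ m) ℚ./ suc n

-- Below b ρ q  :⇔  q < ρ(b)   (value of b under ρ : X → ℕ in ℝ≥0 ∪ {ω},
-- described by its lower Dedekind cut of rationals)
Below : {X : Set} → Bound X → (X → ℕ) → ℚ → Set
Below (bconst c _) ρ q = q ℚ.< c
Below ω            ρ q = ⊤
Below (bvar x)     ρ q = q ℚ.< (+ ρ x) ℚ./ 1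
Below (a ⊞ b)      ρ q = Σ ℚ λ q₁ → Σ ℚ λ q₂ → Below a ρ q₁ × Below b ρ q₂ × q ℚ.< q₁ ℚ.+ q₂
Below (a ⊠ b)      ρ q = q ℚ.< 0ℚ ⊎ (Σ ℚ λ q₁ → Σ ℚ λ q₂ → 0ℚ ℚ.≤ q₁ × 0ℚ ℚ.≤ q₂
                                     × Below a ρ q₁ × Below b ρ q₂ × q ℚ.< q₁ ℚ.* q₂)
Below (bpow k _ b) ρ q = q ℚ.< 1ℚ ⊎ (Σ ℕ λ m → Σ ℕ λ n → Below b ρ (fracℚ m n)
                                     × 0ℚ ℚ.≤ q × q ^ℚ suc n ℚ.< k ^ℚ m)
Below (blog k _ b) ρ q = q ℚ.< 0ℚ ⊎ (Σ ℕ λ m → Σ ℕ λ n → q ℚ.< fracℚ m n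
                                     × Σ ℚ λ y → Below b ρ y × 0ℚ ℚ.≤ y × k ^ℚ m ℚ.< y ^ℚ suc n)
Below (bmax a b)   ρ q = Below a ρ q ⊎ Below b ρ q

_≤ᵇ_[_] : {X : Set} → ℕ → Bound X → (X → ℕ) → Set
k ≤ᵇ b [ ρ ] = ∀ q → q ℚ.< (+ k) ℚ./ 1 → Below b ρ q

-- Loops (φ', η') over {x₁,…,x_d} = Fin d

record Loop (d : ℕ) : Set where
  constructor mkLoop
  field
    lguard : Formula (Fin d)
    lupd   : Fin d → Poly (Fin d)
open Loop public

iterF : ∀ {d} → (Fin d → Poly (Fin d)) → ℕ → Formula (Fin d) → Formula (Fin d)
iterF η zero    φ = φ
iterF η (suc m) φ = bindF η (iterF η m φ)

-- rb is a runtime bound:  |σ|(rb) ≥ rc(σ) = min{ m | σ(η'^m(¬φ')) }  for all σ,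
-- i.e. |σ|(rb) ≥ m whenever σ(η'^j(φ')) holds for all j < m
IsRuntimeBound : ∀ {d} → Loop d → Bound (Fin d) → Set
IsRuntimeBound {d} L rb = ∀ (σ : Fin d → ℤ) m → (∀ j → j ℕ.< m → Holds σ (iterF (lupd L) j (lguard L)))
                      → m ≤ᵇ rb [ ∣_∣ ∘ σ ]

record Corresponds {nV nTV nL d} (t : Trans nV nTV nL) (π : Fin d → Fin nV) (L : Loop d) : Set where
  field
    selfLoop  : src t ≡ tgt t
    injective : ∀ x y → π x ≡ π y → x ≡ y
    guardEq   : guard t ≈F renF (inj₁ ∘ π) (lguard L)
    updateEq  : ∀ x → upd t (π x) ≈P renP (inj₁ ∘ π) (lupd L x)

absσ : ∀ {nV nTV} → State nV nTV → Fin nV → ℕ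
absσ σ v = ∣ σ (inj₁ v) ∣

GoodBound : ∀ {nV nTV nL m n'} → (Fin m → Trans nV nTV nL) → (Fin (suc n') → Fin m)
          → Fin m → Bound (Fin nV) → Set
GoodBound {nV} T cyc j b =
  b ≡ ω ⊎ (Σ (Fin (suc _)) λ i → tgt (T j) ≡ src (T (cyc i)) ×
             Σ ℕ λ d → Σ (Fin d → Fin nV) λ π → Σ (Loop d) λ L → Σ (Bound (Fin d)) λ rb →
               Corresponds (rotChain T cyc i) π L × IsRuntimeBound L rb × b ≡ one ⊞ renB π rb)

IsLocalRuntimeBound : ∀ {nV nTV nL m n'} → (T : Fin m → Trans nV nTV nL) → (cyc : Fin (suc n') → Fin m)
                    → ((j : Fin m) → IsEntry T cyc j → Bound (Fin nV)) → Set
IsLocalRuntimeBound {nV} {nTV} {nL} T cyc f =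
  ∀ (i : Fin _) (j : Fin _) (e : IsEntry T cyc j) (σ : State nV nTV) (k : ℕ) →
  (Σ (State nV nTV) λ σ' → Σ (Config nV nTV nL) λ c'' →
     Step (T j) (src (T j) , σ') (tgt (T j) , σ) ×
     Pow (Star (λ c c' → Σ _ λ i' → Step (T (cyc i')) c c') ⨾ Step (T (cyc i))) k (tgt (T j) , σ) c'')
  → k ≤ᵇ f j e [ absσ σ ]

module Submission where

-- Let r enter the cycle at ℓ_i₀ in state σ. The locations of 𝒞 are pairwise distinct, so a
-- run inside 𝒞 follows t_i₀, t_i₀+1, … cyclically, and two uses of the same t ∈ 𝒞 are at least
-- |𝒞| steps apart: before the second one the run has completed a full round and is back at
-- ℓ_i₀. The updates of 𝒞 contain no temporaries, so the chained guard cannot observe the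
-- temporaries chosen in the individual steps, and a round is exactly one iteration of the
-- loop corresponding to t_i₀ ⋆ … ⋆ t_i₀-1 on the variables renamed by π. Hence k uses of t
-- give k - 1 iterations of that loop from σ ∘ π, so k - 1 ≤ rb(|σ| ∘ π) and k ≤ 1 + π(rb).

open import Defs
open import Data.Nat using (ℕ; suc; zero; pred; _+_; _*_; _%_; _/_; _≤_; _<_; s≤s; z≤n; >-nonZero)
open import Data.Nat.Properties using (+-assoc; +-comm; +-identityʳ; +-cancelˡ-≡; ≤-trans; m≤n+m)
open import Data.Nat.DivMod using (m≡m%n+[m/n]*n; m%n<n; m%n%n≡m%n; %-distribˡ-+; [m+n]%n≡m%n; m<n⇒m%n≡m)
open import Data.Nat.Divisibility using (divides; ∣⇒≤)
open import Data.Nat.Coprimality using (1-coprimeTo) renaming (sym to coprime-sym)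
open import Data.Fin using (Fin; toℕ)
open import Data.Fin.Properties using (toℕ-injective; toℕ<n; toℕ-fromℕ<)
open import Data.Integer as ℤ using (ℤ; +_)
import Data.Integer.Properties as ℤP
open import Data.Rational as ℚ using (ℚ; 1ℚ; mkℚ)
import Data.Rational.Properties as ℚP
open import Data.Rational.Solver using (module +-*-Solver)
open import Data.Unit using (tt)
open import Data.Sum using (inj₁; inj₂)
open import Data.Product using (Σ; ∃; _×_; _,_; proj₁; proj₂)
open import Data.List using (List; []; _∷_; _++_; [_]; map; upTo; applyUpTo)
open import Data.List.Properties using (++-assoc; map-upTo)
open import Data.List.Relation.Unary.All using (All; []; _∷_)
open import Data.List.Relation.Unary.All.Properties using (++⁺; map⁺; applyUpTo⁺₂)
open import Relation.Binary.PropositionalEquality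
  using (_≡_; _≢_; _≗_; refl; sym; trans; cong; cong₂; subst; subst₂; module ≡-Reasoning)
open import Relation.Binary.Construct.Closure.ReflexiveTransitive using (Star; ε; _◅_)
open import Function using (_∘_)

-- Bounds

Below-renB⁺ : ∀ {X Y : Set} (π : X → Y) (b : Bound X) {ρ : Y → ℕ} {q} →
              Below b (ρ ∘ π) q → Below (renB π b) ρ q
Below-renB⁺ π (bconst c _)  h = h
Below-renB⁺ π ω             h = h
Below-renB⁺ π (bvar x)      h = h
Below-renB⁺ π (a ⊞ b) (q₁ , q₂ , h₁ , h₂ , q<) = q₁ , q₂ , Below-renB⁺ π a h₁ , Below-renB⁺ π b h₂ , q<
Below-renB⁺ π (a ⊠ b) (inj₁ q<0) = inj₁ q<0
Below-renB⁺ π (a ⊠ b) (inj₂ (q₁ , q₂ , 0≤q₁ , 0≤q₂ , h₁ , h₂ , q<)) =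
  inj₂ (q₁ , q₂ , 0≤q₁ , 0≤q₂ , Below-renB⁺ π a h₁ , Below-renB⁺ π b h₂ , q<)
Below-renB⁺ π (bpow k _ b) (inj₁ q<1) = inj₁ q<1
Below-renB⁺ π (bpow k _ b) (inj₂ (m , n , h , rest)) = inj₂ (m , n , Below-renB⁺ π b h , rest)
Below-renB⁺ π (blog k _ b) (inj₁ q<0) = inj₁ q<0
Below-renB⁺ π (blog k _ b) (inj₂ (m , n , q< , y , h , rest)) = inj₂ (m , n , q< , y , Below-renB⁺ π b h , rest)
Below-renB⁺ π (bmax a b) (inj₁ h) = inj₁ (Below-renB⁺ π a h)
Below-renB⁺ π (bmax a b) (inj₂ h) = inj₂ (Below-renB⁺ π b h)

≤ᵇ-renB : ∀ {X Y : Set} (π : X → Y) (b : Bound X) {ρ : Y → ℕ} k →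
          k ≤ᵇ b [ ρ ∘ π ] → k ≤ᵇ renB π b [ ρ ]
≤ᵇ-renB π b k k≤b q q<k = Below-renB⁺ π b (k≤b q q<k)

-- With q < s < s' < p + r, take q₁ = s' - r and q₂ = s - s' + r.
<-+-split : ∀ {q : ℚ} p r → q ℚ.< p ℚ.+ r →
            Σ ℚ λ q₁ → Σ ℚ λ q₂ → q₁ ℚ.< p × q₂ ℚ.< r × q ℚ.< q₁ ℚ.+ q₂
<-+-split {q} p r q<p+r with ℚP.<-dense q<p+r
... | s , q<s , s<p+r with ℚP.<-dense s<p+r
... | s' , s<s' , s'<p+r = s' ℚ.- r , s ℚ.- s' ℚ.+ r , q₁<p , q₂<r , subst (q ℚ.<_) (sym sum≡s) q<s
  where
  open +-*-Solver
  q₁<p : s' ℚ.- r ℚ.< p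
  q₁<p = subst (s' ℚ.- r ℚ.<_) (solve 2 (λ p r → (p :+ r) :- r := p) refl p r) (ℚP.+-monoˡ-< (ℚ.- r) s'<p+r)
  q₂<r : s ℚ.- s' ℚ.+ r ℚ.< r
  q₂<r = subst (s ℚ.- s' ℚ.+ r ℚ.<_) (solve 2 (λ s' r → s' :- s' :+ r := r) refl s' r)
               (ℚP.+-monoˡ-< r (ℚP.+-monoˡ-< (ℚ.- s') s<s'))
  sum≡s : s' ℚ.- r ℚ.+ (s ℚ.- s' ℚ.+ r) ≡ s
  sum≡s = solve 3 (λ s s' r → s' :- r :+ (s :- s' :+ r) := s) refl s s' r

+suc/1≡1++/1 : ∀ n → (+ suc n) ℚ./ 1 ≡ 1ℚ ℚ.+ (+ n) ℚ./ 1
+suc/1≡1++/1 n = begin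
  (+ suc n) ℚ./ 1                                  ≡⟨ cong (ℚ._/ 1) +suc≡+n*1+1*1 ⟩
  (+ n ℤ.* + 1 ℤ.+ + 1 ℤ.* + 1) ℚ./ 1              ≡⟨⟩
  mkℚ (+ n) 0 (coprime-sym (1-coprimeTo n)) ℚ.+ 1ℚ ≡⟨ cong (ℚ._+ 1ℚ) (ℚP.normalize-coprime (coprime-sym (1-coprimeTo n))) ⟨
  (+ n) ℚ./ 1 ℚ.+ 1ℚ                               ≡⟨ ℚP.+-comm ((+ n) ℚ./ 1) 1ℚ ⟩
  1ℚ ℚ.+ (+ n) ℚ./ 1                               ∎
  where
  open ≡-Reasoning
  +suc≡+n*1+1*1 : + suc n ≡ + n ℤ.* + 1 ℤ.+ + 1 ℤ.* + 1
  +suc≡+n*1+1*1 = trans (cong +_ (+-comm 1 n)) (cong (ℤ._+ + 1) (sym (ℤP.*-identityʳ (+ n))))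

<-1+pred : ∀ {q : ℚ} k → q ℚ.< (+ k) ℚ./ 1 → q ℚ.< 1ℚ ℚ.+ (+ pred k) ℚ./ 1
<-1+pred {q} zero    q<0 = subst (q ℚ.<_) (+suc/1≡1++/1 0) (ℚP.<-trans q<0 0<1)
  where
  0<1 : (+ 0) ℚ./ 1 ℚ.< (+ 1) ℚ./ 1
  0<1 = ℚP.positive⁻¹ 1ℚ
<-1+pred {q} (suc k) q<k = subst (q ℚ.<_) (+suc/1≡1++/1 k) q<k

≤ᵇ-one⊞ : ∀ {X : Set} (b : Bound X) {ρ} k → pred k ≤ᵇ b [ ρ ] → k ≤ᵇ one ⊞ b [ ρ ]
≤ᵇ-one⊞ b k k-1≤b q q<k =
  let q₁ , q₂ , q₁<1 , q₂<k-1 , q<q₁+q₂ = <-+-split 1ℚ ((+ pred k) ℚ./ 1) (<-1+pred k q<k)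
  in  q₁ , q₂ , q₁<1 , k-1≤b q₂ q₂<k-1 , q<q₁+q₂

-- Cyclic indices

module _ {n' : ℕ} where
  private
    N = suc n'

  toℕ-rot : ∀ (i : Fin N) k → toℕ (rot i k) ≡ (toℕ i + k) % N
  toℕ-rot i k = toℕ-fromℕ< (m%n<n (toℕ i + k) N)

  rot-zero : ∀ (i : Fin N) → rot i 0 ≡ i
  rot-zero i = toℕ-injective (begin
    toℕ (rot i 0)  ≡⟨ toℕ-rot i 0 ⟩
    (toℕ i + 0) % N ≡⟨ cong (_% N) (+-identityʳ (toℕ i)) ⟩
    toℕ i % N      ≡⟨ m<n⇒m%n≡m (toℕ<n i) ⟩
    toℕ i          ∎)
    where open ≡-Reasoning

  rot-period : ∀ (i : Fin N) → rot i N ≡ i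
  rot-period i = toℕ-injective (begin
    toℕ (rot i N)  ≡⟨ toℕ-rot i N ⟩
    (toℕ i + N) % N ≡⟨ [m+n]%n≡m%n (toℕ i) N ⟩
    toℕ i % N      ≡⟨ m<n⇒m%n≡m (toℕ<n i) ⟩
    toℕ i          ∎)
    where open ≡-Reasoning

  rot-+ : ∀ (i : Fin N) a b → rot (rot i a) b ≡ rot i (a + b)
  rot-+ i a b = toℕ-injective (begin
    toℕ (rot (rot i a) b)              ≡⟨ toℕ-rot (rot i a) b ⟩
    (toℕ (rot i a) + b) % N            ≡⟨ cong (λ x → (x + b) % N) (toℕ-rot i a) ⟩
    ((toℕ i + a) % N + b) % N          ≡⟨ %-distribˡ-+ ((toℕ i + a) % N) b N ⟩
    ((toℕ i + a) % N % N + b % N) % N  ≡⟨ cong (λ x → (x + b % N) % N) (m%n%n≡m%n (toℕ i + a) N) ⟩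
    ((toℕ i + a) % N + b % N) % N      ≡⟨ %-distribˡ-+ (toℕ i + a) b N ⟨
    (toℕ i + a + b) % N                ≡⟨ cong (_% N) (+-assoc (toℕ i) a b) ⟩
    (toℕ i + (a + b)) % N              ≡⟨ toℕ-rot i (a + b) ⟨
    toℕ (rot i (a + b))                ∎)
    where open ≡-Reasoning

  rot-suc : ∀ (i : Fin N) s → rot (rot i s) 1 ≡ rot i (suc s)
  rot-suc i s = trans (rot-+ i s 1) (cong (rot i) (+-comm s 1))

  rot-return⇒N≤ : ∀ (i : Fin N) {e} → 0 < e → rot i e ≡ i → N ≤ e
  rot-return⇒N≤ i {e} 0<e rot-i-e≡i = ∣⇒≤ {{>-nonZero 0<e}} (divides ((toℕ i + e) / N) e≡q*N)
    where
    open ≡-Reasoning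
    [i+e]%N≡i : (toℕ i + e) % N ≡ toℕ i
    [i+e]%N≡i = trans (sym (toℕ-rot i e)) (cong toℕ rot-i-e≡i)
    e≡q*N : e ≡ (toℕ i + e) / N * N
    e≡q*N = +-cancelˡ-≡ (toℕ i) e ((toℕ i + e) / N * N) (begin
      toℕ i + e                             ≡⟨ m≡m%n+[m/n]*n (toℕ i + e) N ⟩
      (toℕ i + e) % N + (toℕ i + e) / N * N ≡⟨ cong (_+ (toℕ i + e) / N * N) [i+e]%N≡i ⟩
      toℕ i + (toℕ i + e) / N * N           ∎)

-- Polynomials, formulas and loops

evalP-cong : ∀ {X : Set} (p : Poly X) {σ σ' : X → ℤ} → σ ≗ σ' → evalP p σ ≡ evalP p σ'
evalP-cong (pconst c) σ≗σ' = refl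
evalP-cong (pvar x)   σ≗σ' = σ≗σ' x
evalP-cong (p ⊕ q)    σ≗σ' = cong₂ ℤ._+_ (evalP-cong p σ≗σ') (evalP-cong q σ≗σ')
evalP-cong (p ⊗ q)    σ≗σ' = cong₂ ℤ._*_ (evalP-cong p σ≗σ') (evalP-cong q σ≗σ')

Holds-cong : ∀ {X : Set} (φ : Formula X) {σ σ' : X → ℤ} → σ ≗ σ' → Holds σ φ → Holds σ' φ
Holds-cong (p <' q) σ≗σ' h = subst₂ ℤ._<_ (evalP-cong p σ≗σ') (evalP-cong q σ≗σ') h
Holds-cong (φ ∧' ψ) σ≗σ' (h₁ , h₂) = Holds-cong φ σ≗σ' h₁ , Holds-cong ψ σ≗σ' h₂
Holds-cong (φ ∨' ψ) σ≗σ' (inj₁ h) = inj₁ (Holds-cong φ σ≗σ' h)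
Holds-cong (φ ∨' ψ) σ≗σ' (inj₂ h) = inj₂ (Holds-cong ψ σ≗σ' h)

evalP-bindP : ∀ {X Y : Set} (s : X → Poly Y) (p : Poly X) (σ : Y → ℤ) →
              evalP (bindP s p) σ ≡ evalP p (λ x → evalP (s x) σ)
evalP-bindP s (pconst c) σ = refl
evalP-bindP s (pvar x)   σ = refl
evalP-bindP s (p ⊕ q)    σ = cong₂ ℤ._+_ (evalP-bindP s p σ) (evalP-bindP s q σ)
evalP-bindP s (p ⊗ q)    σ = cong₂ ℤ._*_ (evalP-bindP s p σ) (evalP-bindP s q σ)

Holds-bindF⁺ : ∀ {X Y : Set} (s : X → Poly Y) (φ : Formula X) {σ : Y → ℤ} →
               Holds (λ x → evalP (s x) σ) φ → Holds σ (bindF s φ)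
Holds-bindF⁺ s (p <' q) {σ} h = subst₂ ℤ._<_ (sym (evalP-bindP s p σ)) (sym (evalP-bindP s q σ)) h
Holds-bindF⁺ s (φ ∧' ψ) (h₁ , h₂) = Holds-bindF⁺ s φ h₁ , Holds-bindF⁺ s ψ h₂
Holds-bindF⁺ s (φ ∨' ψ) (inj₁ h) = inj₁ (Holds-bindF⁺ s φ h)
Holds-bindF⁺ s (φ ∨' ψ) (inj₂ h) = inj₂ (Holds-bindF⁺ s ψ h)

Holds-bindF⁻ : ∀ {X Y : Set} (s : X → Poly Y) (φ : Formula X) {σ : Y → ℤ} →
               Holds σ (bindF s φ) → Holds (λ x → evalP (s x) σ) φ
Holds-bindF⁻ s (p <' q) {σ} h = subst₂ ℤ._<_ (evalP-bindP s p σ) (evalP-bindP s q σ) h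
Holds-bindF⁻ s (φ ∧' ψ) (h₁ , h₂) = Holds-bindF⁻ s φ h₁ , Holds-bindF⁻ s ψ h₂
Holds-bindF⁻ s (φ ∨' ψ) (inj₁ h) = inj₁ (Holds-bindF⁻ s φ h)
Holds-bindF⁻ s (φ ∨' ψ) (inj₂ h) = inj₂ (Holds-bindF⁻ s ψ h)

Holds-≈F : ∀ {X : Set} {φ φ' : Formula X} {σ : X → ℤ} → φ ≈F φ' → Holds σ φ → Holds σ φ'
Holds-≈F {σ = σ} (atom≈ p≈p' q≈q') h = subst₂ ℤ._<_ (p≈p' σ) (q≈q' σ) h
Holds-≈F (∧≈ φ≈φ' ψ≈ψ') (h₁ , h₂) = Holds-≈F φ≈φ' h₁ , Holds-≈F ψ≈ψ' h₂
Holds-≈F (∨≈ φ≈φ' ψ≈ψ') (inj₁ h) = inj₁ (Holds-≈F φ≈φ' h)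
Holds-≈F (∨≈ φ≈φ' ψ≈ψ') (inj₂ h) = inj₂ (Holds-≈F ψ≈ψ' h)

nextState : ∀ {d} → Loop d → (Fin d → ℤ) → Fin d → ℤ
nextState L ρ x = evalP (lupd L x) ρ

LoopStep : ∀ {d} → Loop d → (Fin d → ℤ) → (Fin d → ℤ) → Set
LoopStep L ρ ρ' = Holds ρ (lguard L) × ρ' ≗ nextState L ρ

RunsAtLeast : ∀ {d} → Loop d → ℕ → (Fin d → ℤ) → Set
RunsAtLeast L m ρ = ∀ j → j < m → Holds ρ (iterF (lupd L) j (lguard L))

RunsAtLeast-step : ∀ {d} (L : Loop d) {k ρ ρ'} → LoopStep L ρ ρ' → RunsAtLeast L k ρ' → RunsAtLeast L (suc k) ρ
RunsAtLeast-step L (g , _) runs zero    _ = g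
RunsAtLeast-step L (_ , ρ'≗) runs (suc j) (s≤s j<k) =
  Holds-bindF⁺ (lupd L) (iterF (lupd L) j (lguard L)) (Holds-cong _ ρ'≗ (runs j j<k))

-- Program states, updates and temporary variables

module _ {nV nTV : ℕ} where
  private
    St = State nV nTV

  Agree : St → St → Set
  Agree σ σ' = ∀ v → σ (inj₁ v) ≡ σ' (inj₁ v)

  IgnoresTemps : Poly (Var nV nTV) → Set
  IgnoresTemps p = ∀ {σ σ'} → Agree σ σ' → evalP p σ ≡ evalP p σ'

  -- Required atomwise: a conjunction can ignore temporaries while its conjuncts do not.
  AtomsIgnoreTemps : Formula (Var nV nTV) → Set
  AtomsIgnoreTemps (p <' q) = IgnoresTemps p × IgnoresTemps q
  AtomsIgnoreTemps (φ ∧' ψ) = AtomsIgnoreTemps φ × AtomsIgnoreTemps ψ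
  AtomsIgnoreTemps (φ ∨' ψ) = AtomsIgnoreTemps φ × AtomsIgnoreTemps ψ

  Holds-agree : ∀ φ → AtomsIgnoreTemps φ → ∀ {σ σ'} → Agree σ σ' → Holds σ φ → Holds σ' φ
  Holds-agree (p <' q) (p-ign , q-ign) σ≈σ' h = subst₂ ℤ._<_ (p-ign σ≈σ') (q-ign σ≈σ') h
  Holds-agree (φ ∧' ψ) (φ-ign , ψ-ign) σ≈σ' (h₁ , h₂) =
    Holds-agree φ φ-ign σ≈σ' h₁ , Holds-agree ψ ψ-ign σ≈σ' h₂
  Holds-agree (φ ∨' ψ) (φ-ign , _) σ≈σ' (inj₁ h) = inj₁ (Holds-agree φ φ-ign σ≈σ' h)
  Holds-agree (φ ∨' ψ) (_ , ψ-ign) σ≈σ' (inj₂ h) = inj₂ (Holds-agree ψ ψ-ign σ≈σ' h)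

  AtomsIgnoreTemps-≈F : ∀ {φ φ'} → φ ≈F φ' → AtomsIgnoreTemps φ' → AtomsIgnoreTemps φ
  AtomsIgnoreTemps-≈F (atom≈ p≈p' q≈q') (p'-ign , q'-ign) =
    (λ {σ} {σ'} σ≈σ' → trans (p≈p' σ) (trans (p'-ign σ≈σ') (sym (p≈p' σ')))) ,
    (λ {σ} {σ'} σ≈σ' → trans (q≈q' σ) (trans (q'-ign σ≈σ') (sym (q≈q' σ'))))
  AtomsIgnoreTemps-≈F (∧≈ φ≈φ' ψ≈ψ') (φ'-ign , ψ'-ign) =
    AtomsIgnoreTemps-≈F φ≈φ' φ'-ign , AtomsIgnoreTemps-≈F ψ≈ψ' ψ'-ign
  AtomsIgnoreTemps-≈F (∨≈ φ≈φ' ψ≈ψ') (φ'-ign , ψ'-ign) =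
    AtomsIgnoreTemps-≈F φ≈φ' φ'-ign , AtomsIgnoreTemps-≈F ψ≈ψ' ψ'-ign

  IgnoresTemps-bindP : ∀ {X : Set} {s : X → Poly (Var nV nTV)} → (∀ x → IgnoresTemps (s x)) →
                       ∀ p → IgnoresTemps (bindP s p)
  IgnoresTemps-bindP {s = s} s-ign p {σ} {σ'} σ≈σ' = begin
    evalP (bindP s p) σ            ≡⟨ evalP-bindP s p σ ⟩
    evalP p (λ x → evalP (s x) σ)  ≡⟨ evalP-cong p (λ x → s-ign x σ≈σ') ⟩
    evalP p (λ x → evalP (s x) σ') ≡⟨ evalP-bindP s p σ' ⟨
    evalP (bindP s p) σ'           ∎
    where open ≡-Reasoning

  AtomsIgnoreTemps-renF : ∀ {X : Set} (π : X → Fin nV) φ → AtomsIgnoreTemps (renF (inj₁ ∘ π) φ)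
  AtomsIgnoreTemps-renF π (p <' q) = IgnoresTemps-bindP (λ x σ≈σ' → σ≈σ' (π x)) p ,
                                     IgnoresTemps-bindP (λ x σ≈σ' → σ≈σ' (π x)) q
  AtomsIgnoreTemps-renF π (φ ∧' ψ) = AtomsIgnoreTemps-renF π φ , AtomsIgnoreTemps-renF π ψ
  AtomsIgnoreTemps-renF π (φ ∨' ψ) = AtomsIgnoreTemps-renF π φ , AtomsIgnoreTemps-renF π ψ

  NoTemp⇒IgnoresTemps : ∀ p → NoTemp p → IgnoresTemps p
  NoTemp⇒IgnoresTemps (pconst c)      _ σ≈σ' = refl
  NoTemp⇒IgnoresTemps (pvar (inj₁ v)) _ σ≈σ' = σ≈σ' v
  NoTemp⇒IgnoresTemps (p ⊕ q) (p-nt , q-nt) σ≈σ' =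
    cong₂ ℤ._+_ (NoTemp⇒IgnoresTemps p p-nt σ≈σ') (NoTemp⇒IgnoresTemps q q-nt σ≈σ')
  NoTemp⇒IgnoresTemps (p ⊗ q) (p-nt , q-nt) σ≈σ' =
    cong₂ ℤ._*_ (NoTemp⇒IgnoresTemps p p-nt σ≈σ') (NoTemp⇒IgnoresTemps q q-nt σ≈σ')

  TempFree : Update nV nTV → Set
  TempFree η = ∀ v → NoTemp (η v)

  update : Update nV nTV → St → St
  update η σ (inj₁ v) = evalP (η v) σ
  update η σ (inj₂ w) = σ (inj₂ w)

  updateAll : List (Update nV nTV) → St → St
  updateAll []       σ = σ
  updateAll (η ∷ ηs) σ = updateAll ηs (update η σ)

  updateAll-++ : ∀ ηs ηs' σ → updateAll (ηs ++ ηs') σ ≡ updateAll ηs' (updateAll ηs σ)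
  updateAll-++ []       ηs' σ = refl
  updateAll-++ (η ∷ ηs) ηs' σ = updateAll-++ ηs ηs' (update η σ)

  updateAll-temp : ∀ ηs σ w → updateAll ηs σ (inj₂ w) ≡ σ (inj₂ w)
  updateAll-temp []       σ w = refl
  updateAll-temp (η ∷ ηs) σ w = updateAll-temp ηs (update η σ) w

  updateAll-agree : ∀ {ηs} → All TempFree ηs → ∀ {σ σ'} → Agree σ σ' → Agree (updateAll ηs σ) (updateAll ηs σ')
  updateAll-agree []                      σ≈σ' = σ≈σ'
  updateAll-agree {η ∷ ηs} (η-tf ∷ ηs-tf) σ≈σ' =
    updateAll-agree ηs-tf (λ v → NoTemp⇒IgnoresTemps (η v) (η-tf v) σ≈σ')

  evalP-applyAllP : ∀ ηs p σ → evalP (applyAllP ηs p) σ ≡ evalP p (updateAll ηs σ)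
  evalP-applyAllP []       p σ = refl
  evalP-applyAllP (η ∷ ηs) p σ = begin
    evalP (substP η (applyAllP ηs p)) σ ≡⟨ evalP-bindP _ (applyAllP ηs p) σ ⟩
    evalP (applyAllP ηs p) _            ≡⟨ evalP-cong (applyAllP ηs p) (λ { (inj₁ v) → refl ; (inj₂ w) → refl }) ⟩
    evalP (applyAllP ηs p) (update η σ) ≡⟨ evalP-applyAllP ηs p (update η σ) ⟩
    evalP p (updateAll ηs (update η σ)) ∎
    where open ≡-Reasoning

  Holds-applyAllF⁺ : ∀ ηs φ {σ} → Holds (updateAll ηs σ) φ → Holds σ (applyAllF ηs φ)
  Holds-applyAllF⁺ []       φ h = h
  Holds-applyAllF⁺ (η ∷ ηs) φ h =
    Holds-bindF⁺ _ (applyAllF ηs φ)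
      (Holds-cong (applyAllF ηs φ) (λ { (inj₁ v) → refl ; (inj₂ w) → refl }) (Holds-applyAllF⁺ ηs φ h))

  Agree-update : ∀ pre η → TempFree η → ∀ {σ τ τ'} → Agree τ (updateAll pre σ) →
                 (∀ v → τ' (inj₁ v) ≡ evalP (η v) τ) → Agree τ' (updateAll (pre ++ [ η ]) σ)
  Agree-update pre η η-tf {σ} {τ} {τ'} τ≈ τ'≡ v = begin
    τ' (inj₁ v)                            ≡⟨ τ'≡ v ⟩
    evalP (η v) τ                          ≡⟨ NoTemp⇒IgnoresTemps (η v) (η-tf v) τ≈ ⟩
    evalP (η v) (updateAll pre σ)          ≡⟨ cong (λ σ' → σ' (inj₁ v)) (updateAll-++ pre [ η ] σ) ⟨
    updateAll (pre ++ [ η ]) σ (inj₁ v)    ∎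
    where open ≡-Reasoning

  -- Each step of a run may pick its own temporaries; στ supplies those of τ to the
  -- chained guard, which cannot observe them.
  Holds-applyAllF-agree : ∀ {ηs} → All TempFree ηs → ∀ φ → AtomsIgnoreTemps (applyAllF ηs φ) →
                          ∀ {σ τ} → Agree τ (updateAll ηs σ) → Holds τ φ → Holds σ (applyAllF ηs φ)
  Holds-applyAllF-agree {ηs} ηs-tf φ ign {σ} {τ} τ≈ h =
    Holds-agree (applyAllF ηs φ) ign (λ _ → refl) (Holds-applyAllF⁺ ηs φ (Holds-cong φ τ≗ h))
    where
    στ : St
    στ (inj₁ v) = σ (inj₁ v)
    στ (inj₂ w) = τ (inj₂ w)
    τ≗ : τ ≗ updateAll ηs στ
    τ≗ (inj₁ v) = trans (τ≈ v) (updateAll-agree ηs-tf (λ _ → refl) v)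
    τ≗ (inj₂ w) = sym (updateAll-temp ηs στ w)

  Run : ∀ {nL} → List (Trans nV nTV nL) → St → St → Set
  Run []       τ τ'  = Agree τ τ'
  Run (t ∷ ts) τ τ'' = Σ St λ τ' → (Holds τ (guard t) × (∀ v → τ' (inj₁ v) ≡ evalP (upd t v) τ)) × Run ts τ' τ''

  Run⇒chainGuard : ∀ {nL} pre (t : Trans nV nTV nL) ts → All TempFree pre → All (TempFree ∘ upd) (t ∷ ts) →
                   AtomsIgnoreTemps (chainGuard pre t ts) → ∀ {σ τ τ''} → Agree τ (updateAll pre σ) →
                   Run (t ∷ ts) τ τ'' →
                   Holds σ (chainGuard pre t ts) × Agree τ'' (updateAll (pre ++ map upd (t ∷ ts)) σ)
  Run⇒chainGuard pre t [] pre-tf (t-tf ∷ []) ign {σ} τ≈ (τ₁ , (g , u) , τ₁≈τ'') =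
    Holds-applyAllF-agree pre-tf (guard t) ign {σ} τ≈ g ,
    λ v → trans (sym (τ₁≈τ'' v)) (Agree-update pre (upd t) t-tf {σ} {τ' = τ₁} τ≈ u v)
  Run⇒chainGuard pre t (t' ∷ ts) pre-tf (t-tf ∷ ts-tf) (ign₁ , ign₂) {σ} τ≈ (τ₁ , (g , u) , run)
    with Run⇒chainGuard (pre ++ [ upd t ]) t' ts (++⁺ pre-tf (t-tf ∷ [])) ts-tf ign₂ {σ}
                        (Agree-update pre (upd t) t-tf {σ} {τ' = τ₁} τ≈ u) run
  ... | h , τ''≈ =
    (Holds-applyAllF-agree pre-tf (guard t) ign₁ {σ} τ≈ g , h) ,
    λ v → trans (τ''≈ v) (cong (λ ηs → updateAll ηs σ (inj₁ v)) (++-assoc pre [ upd t ] (map upd (t' ∷ ts))))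

  Run⇒LoopStep : ∀ {nL d} {t : Trans nV nTV nL} {ts} {π : Fin d → Fin nV} {L : Loop d} →
                 Corresponds (chain t ts) π L → All (TempFree ∘ upd) (t ∷ ts) →
                 ∀ {σ σ'} → Run (t ∷ ts) σ σ' → LoopStep L (σ ∘ inj₁ ∘ π) (σ' ∘ inj₁ ∘ π)
  Run⇒LoopStep {t = t} {ts} {π} {L} corr tf {σ} {σ'} run =
    Holds-bindF⁻ _ (lguard L) (Holds-≈F guardEq (proj₁ chain-sound)) , σ'≗
    where
    open Corresponds corr
    open ≡-Reasoning
    chain-sound : Holds σ (guard (chain t ts)) × Agree σ' (updateAll (map upd (t ∷ ts)) σ)
    chain-sound = Run⇒chainGuard [] t ts [] tf
      (AtomsIgnoreTemps-≈F guardEq (AtomsIgnoreTemps-renF π (lguard L))) (λ _ → refl) run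
    σ'≗ : ∀ x → σ' (inj₁ (π x)) ≡ nextState L (σ ∘ inj₁ ∘ π) x
    σ'≗ x = begin
      σ' (inj₁ (π x))                              ≡⟨ proj₂ chain-sound (π x) ⟩
      updateAll (map upd (t ∷ ts)) σ (inj₁ (π x))  ≡⟨ evalP-applyAllP (map upd (t ∷ ts)) (pvar (inj₁ (π x))) σ ⟨
      evalP (upd (chain t ts) (π x)) σ             ≡⟨ updateEq x σ ⟩
      evalP (renP (inj₁ ∘ π) (lupd L x)) σ         ≡⟨ evalP-bindP _ (lupd L x) σ ⟩
      nextState L (σ ∘ inj₁ ∘ π) x                 ∎

module _ {A : Set} {R : A → A → Set} where

  Pow-++ : ∀ {a b x y z} → Pow R a x y → Pow R b y z → Pow R (a + b) x z
  Pow-++ {zero}  refl        q = q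
  Pow-++ {suc a} (c , r , p) q = c , r , Pow-++ p q

  Pow⇒Star : ∀ {n x y} → Pow R n x y → Star R x y
  Pow⇒Star {zero}  refl        = ε
  Pow⇒Star {suc n} (c , r , p) = r ◅ Pow⇒Star p

  Star⇒Pow : ∀ {x y} → Star R x y → ∃ λ n → Pow R n x y
  Star⇒Pow ε       = 0 , refl
  Star⇒Pow (r ◅ s) with Star⇒Pow s
  ... | n , p = suc n , _ , r , p

  Pow-prefix : ∀ {a n x z} → a ≤ n → Pow R n x z → ∃ λ y → Pow R a x y × Star R y z
  Pow-prefix z≤n       p           = _ , refl , Pow⇒Star p
  Pow-prefix (s≤s a≤n) (c , r , p) with Pow-prefix a≤n p
  ... | y , p₁ , s = y , (c , r , p₁) , s

-- Runs inside a simple cycle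

module Cycle {nV nTV nL m n'} (T : Fin m → Trans nV nTV nL) (cyc : Fin (suc n') → Fin m)
             (sc : SimpleCycle T cyc) where
  open SimpleCycle sc

  private
    N = suc n'
    Cfg = Config nV nTV nL

    t : Fin N → Trans nV nTV nL
    t = T ∘ cyc

  CycleStep : Cfg → Cfg → Set
  CycleStep c c' = Σ (Fin N) λ i → Step (t i) c c'

  Visits : Fin N → Cfg → Cfg → Set
  Visits i = Star CycleStep ⨾ Step (t i)

  -- The locations of the cycle are pairwise distinct, so a run inside it is forced to follow
  -- t (f 0), t (f 1), …
  walk : ∀ k (f : ℕ → Fin N) → (∀ s → rot (f s) 1 ≡ f (suc s)) → ∀ {c c'} → proj₁ c ≡ src (t (f 0)) →
         Pow CycleStep k c c' → Run (applyUpTo (t ∘ f) k) (proj₂ c) (proj₂ c') × proj₁ c' ≡ src (t (f k))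
  walk zero    f f-next at refl = (λ _ → refl) , at
  walk (suc k) f f-next at (c₁ , (i , c-src , c₁-tgt , g , u) , p) with distinct (f 0) i (trans (sym at) c-src)
  ... | refl with walk k (f ∘ suc) (f-next ∘ suc) (trans c₁-tgt (trans (linked (f 0)) (cong (src ∘ t) (f-next 0)))) p
  ... | run , at' = (proj₂ c₁ , (g , u) , run) , at'

  walkFrom : ∀ i k {c c'} → proj₁ c ≡ src (t i) → Pow CycleStep k c c' →
             Run (applyUpTo (t ∘ rot i) k) (proj₂ c) (proj₂ c') × proj₁ c' ≡ src (t (rot i k))
  walkFrom i k at = walk k (rot i) (rot-suc i) (trans at (cong (src ∘ t) (sym (rot-zero i))))

  round⇒Run : ∀ i {c c'} → proj₁ c ≡ src (t i) → Pow CycleStep N c c' →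
              Run (t i ∷ map (λ k → t (rot i (suc k))) (upTo n')) (proj₂ c) (proj₂ c')
  round⇒Run i at p = subst₂ (λ j ts → Run (t j ∷ ts) _ _) (rot-zero i) (sym (map-upTo _ n'))
                            (proj₁ (walkFrom i N at p))

  round-returns : ∀ i {c c'} → proj₁ c ≡ src (t i) → Pow CycleStep N c c' → proj₁ c' ≡ src (t i)
  round-returns i at p = trans (proj₂ (walkFrom i N at p)) (cong (src ∘ t) (rot-period i))

  rotChain-tempFree : ∀ i → All (TempFree ∘ upd) (t i ∷ map (λ k → t (rot i (suc k))) (upTo n'))
  rotChain-tempFree i = noTemp i ∷ map⁺ (applyUpTo⁺₂ _ n' (λ k → noTemp (rot i (suc k))))

  revisit⇒N≤ : ∀ i₀ i {a b c x y} → proj₁ c ≡ src (t i₀) → Pow CycleStep a c x → Pow CycleStep (a + b) c y →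
               proj₁ x ≡ src (t i) → proj₁ y ≡ src (t i) → 0 < b → N ≤ b
  revisit⇒N≤ i₀ i {a} {b} at p q x-at y-at 0<b = rot-return⇒N≤ i 0<b (begin
    rot i b          ≡⟨ cong (λ j → rot j b) (visit p x-at) ⟨
    rot (rot i₀ a) b ≡⟨ rot-+ i₀ a b ⟩
    rot i₀ (a + b)   ≡⟨ visit q y-at ⟩
    i                ∎)
    where
    open ≡-Reasoning
    visit : ∀ {k z} → Pow CycleStep k _ z → proj₁ z ≡ src (t i) → rot i₀ k ≡ i
    visit {k} r z-at = distinct _ _ (trans (sym (proj₂ (walkFrom i₀ k at r))) z-at)

  twoVisits⇒round : ∀ i₀ i {c c₂} → proj₁ c ≡ src (t i₀) → (Visits i ⨾ Visits i) c c₂ →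
                    ∃ λ c' → Pow CycleStep N c c' × Visits i c' c₂
  twoVisits⇒round i₀ i at (c₁ , (a₁ , s₁ , st₁) , (a₂ , s₂ , st₂)) =
    let ℓ₁ , p₁ = Star⇒Pow s₁
        ℓ₂ , p₂ = Star⇒Pow s₂
        p = Pow-++ p₁ (c₁ , (i , st₁) , p₂)
        N≤ = ≤-trans (revisit⇒N≤ i₀ i at p₁ p (proj₁ st₁) (proj₁ st₂) (s≤s z≤n)) (m≤n+m (suc ℓ₂) ℓ₁)
        c' , round , s = Pow-prefix N≤ p
    in  c' , round , a₂ , s , st₂

  module _ {i₀ d} {π : Fin d → Fin nV} {L : Loop d} (corr : Corresponds (rotChain T cyc i₀) π L) where

    visits⇒RunsAtLeast : ∀ i k {c c''} → proj₁ c ≡ src (t i₀) → Pow (Visits i) k c c'' →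
                         RunsAtLeast L (pred k) (proj₂ c ∘ inj₁ ∘ π)
    visits⇒RunsAtLeast i zero          at _ = λ _ ()
    visits⇒RunsAtLeast i (suc zero)    at _ = λ _ ()
    visits⇒RunsAtLeast i (suc (suc k)) at (c₁ , v₁ , c₂ , v₂ , rest) =
      let c' , round , v = twoVisits⇒round i₀ i {c₂ = c₂} at (c₁ , v₁ , v₂)
      in  RunsAtLeast-step L (Run⇒LoopStep corr (rotChain-tempFree i₀) (round⇒Run i₀ at round))
                             (visits⇒RunsAtLeast i (suc k) (round-returns i₀ at round) (c₂ , v , rest))

lemma7 : ∀ {nV nTV nL m n'} (ℓ₀ : Fin nL) (T : Fin m → Trans nV nTV nL)
             → (∀ j → tgt (T j) ≢ ℓ₀)
             → (cyc : Fin (suc n') → Fin m) → SimpleCycle T cyc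
             → (f : (j : Fin m) → IsEntry T cyc j → Bound (Fin nV))
             → (∀ j (e : IsEntry T cyc j) → GoodBound T cyc j (f j e))
             → IsLocalRuntimeBound T cyc f
lemma7 ℓ₀ T _ cyc sc f good i j e σ k (_ , _ , _ , visits) with f j e | good j e
... | .ω                  | inj₁ refl = λ _ _ → tt
... | .(one ⊞ renB π rb) | inj₂ (i₀ , entry-at , d , π , L , rb , corr , rb-bound , refl) =
  ≤ᵇ-one⊞ (renB π rb) k (≤ᵇ-renB π rb (pred k) (rb-bound (σ ∘ inj₁ ∘ π) (pred k) (visits⇒RunsAtLeast corr i k entry-at visits)))
  where open Cycle T cyc sc
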